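{- For all integers $n,k\ge0$, $\sum_{\lambda\in\mathcal{E}_n^k}x^{w_{\mathcal{E}}^{\mathrm{lr}}(\lambda)}=\widehat{\mathscr{B}}_n^k(x)$ (where for $n=0$ or $k=0$ the left side is taken to be $1$).
   Context: $\widehat{\mathscr{B}}_n^k(x)=\sum_{j=0}^{\min(n,k)} j!\,(x+1)(x+2)\cdots(x+j)\,S(n+1,j+1)\,S(k+1,j+1)$, $S$ the Stirling numbers of the second kind. $[m]=\{1,\dots,m\}$. $\mathcal{E}_n^k$ is the set of permutations $\lambda$ of $[n+k+1]$ whose excedance set $\{i:\lambda(i)>i\}$ equals $[n]$. $w_{\mathcal{E}}^{\mathrm{lr}}(\lambda)$ is the number of $i\in\{n+1,\dots,n+k+1\}$ such that $\lambda(i)<\lambda(j)$ for all $j$ with $n<j<i$, minus one. -}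

module Defs where

open import Data.Nat using (ℕ; zero; suc; _!; _+_; _*_; _∸_; _^_; _≤_; _<_; _⊓_)
open import Data.Nat.Properties using (_≤?_; _<?_)
open import Data.Nat.ListAction using (sum)
open import Data.Fin using (Fin; toℕ)
open import Data.Fin.Properties using (all?) renaming (_≟_ to _≟ᶠ_)
open import Data.Vec using (Vec; []; _∷_; lookup)
open import Data.List using (List; []; _∷_; map; concatMap; filter; upTo; length; allFin; foldr)
open import Data.Product using (_×_)
open import Relation.Nullary using (¬_; Dec)
open import Relation.Nullary.Decidable using (_×-dec_; _→-dec_; ¬?)
open import Relation.Binary.PropositionalEquality using (_≡_)

S : ℕ → ℕ → ℕ
S zero    zero    = 1
S zero    (suc k) = 0
S (suc n) zero    = 0
S (suc n) (suc k) = suc k * S n (suc k) + S n k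

rise : ℕ → ℕ → ℕ
rise x zero    = 1
rise x (suc j) = rise x j * (x + suc j)

Bhat : ℕ → ℕ → ℕ → ℕ
Bhat n k x = sum (map (λ j → (j !) * rise x j * S (suc n) (suc j) * S (suc k) (suc j))
                      (upTo (suc (n ⊓ k))))

allVecs : {A : Set} → List A → (m : ℕ) → List (Vec A m)
allVecs xs zero    = [] ∷ []
allVecs xs (suc m) = concatMap (λ a → map (a ∷_) (allVecs xs m)) xs

-- A vector v : Vec (Fin N) N is read as the map i ↦ lookup v i on Fin N
-- (0-based positions/values; position i stands for i+1 ∈ [N]).
IsPerm : {N : ℕ} → Vec (Fin N) N → Set
IsPerm {N} v = (i j : Fin N) → lookup v i ≡ lookup v j → i ≡ j

isPerm? : {N : ℕ} → (v : Vec (Fin N) N) → Dec (IsPerm v)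
isPerm? v = all? (λ i → all? (λ j → (lookup v i ≟ᶠ lookup v j) →-dec (i ≟ᶠ j)))

ExcSetIs : {N : ℕ} → ℕ → Vec (Fin N) N → Set
ExcSetIs {N} n v = (i : Fin N) →
  (toℕ i < n → toℕ i < toℕ (lookup v i)) × (¬ toℕ i < n → ¬ toℕ i < toℕ (lookup v i))

excSetIs? : {N : ℕ} → (n : ℕ) → (v : Vec (Fin N) N) → Dec (ExcSetIs n v)
excSetIs? n v = all? (λ i →
  ((toℕ i <? n) →-dec (toℕ i <? toℕ (lookup v i))) ×-dec
  (¬? (toℕ i <? n) →-dec ¬? (toℕ i <? toℕ (lookup v i))))

InE : (n k : ℕ) → Vec (Fin (n + k + 1)) (n + k + 1) → Set
InE n k v = IsPerm v × ExcSetIs n v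

inE? : (n k : ℕ) → (v : Vec (Fin (n + k + 1)) (n + k + 1)) → Dec (InE n k v)
inE? n k v = isPerm? v ×-dec excSetIs? n v

E : (n k : ℕ) → List (Vec (Fin (n + k + 1)) (n + k + 1))
E n k = filter (inE? n k) (allVecs (allFin (n + k + 1)) (n + k + 1))

LRMin : {N : ℕ} → ℕ → Vec (Fin N) N → Fin N → Set
LRMin {N} n v i = (n ≤ toℕ i) ×
  ((j : Fin N) → n ≤ toℕ j → toℕ j < toℕ i → toℕ (lookup v i) < toℕ (lookup v j))

lrMin? : {N : ℕ} → (n : ℕ) → (v : Vec (Fin N) N) → (i : Fin N) → Dec (LRMin n v i)
lrMin? n v i = (n ≤? toℕ i) ×-dec
  all? (λ j → (n ≤? toℕ j) →-dec ((toℕ j <? toℕ i) →-dec (toℕ (lookup v i) <? toℕ (lookup v j))))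

wlr : {N : ℕ} → ℕ → Vec (Fin N) N → ℕ
wlr {N} n v = length (filter (lrMin? n v) (allFin N)) ∸ 1

lhs : ℕ → ℕ → ℕ → ℕ
lhs n k x = sum (map (λ v → x ^ wlr n v) (E n k))

module Submission where

open import Data.Nat using (ℕ; zero; suc; _+_; _*_; _∸_; _^_; _<_; _≤_; s≤s; z≤n; s≤s⁻¹; _!; _⊓_)
open import Data.Nat.Properties
open import Data.Nat.ListAction using (sum)
open import Data.Nat.ListAction.Properties using (sum-++; sum-↭)
open import Data.Nat.Tactic.RingSolver using (solve-∀)
open import Data.Fin using (Fin; zero; suc; toℕ; fromℕ<; punchIn; punchOut)
open import Data.Fin.Properties
  using (all?; any?; toℕ<n; toℕ-fromℕ<; toℕ-injective; punchIn-injective; punchInᵢ≢i; punchOut-punchIn;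
         punchIn-punchOut; punchIn-mono-≤; punchIn-cancel-≤)
  renaming (_≟_ to _≟ᶠ_)
open import Data.Vec using (Vec; []; _∷_; lookup; insertAt)
import Data.Vec as Vec
open import Data.Vec.Properties
  using (∷-injective; insertAt-lookup; insertAt-punchIn; lookup-map; lookup∘tabulate; tabulate∘lookup; tabulate-cong)
open import Data.List
  using (List; []; _∷_; map; _++_; concatMap; filter; length; allFin; tabulate; upTo; [_]; cartesianProduct; cartesianProductWith)
open import Data.List.Properties
  using (map-∘; map-++; map-id-local; map-cong; map-cong-local; map-tabulate; length-map; length-tabulate; upTo-∷ʳ;
         filter-none; filter-≐)
open import Data.List.Membership.Propositional using (_∈_)
open import Data.List.Membership.Propositional.Properties
  using (∈-map⁺; ∈-map⁻; ∈-++⁺ˡ; ∈-++⁺ʳ; ∈-++⁻; ∈-cartesianProductWith⁺; ∈-cartesianProduct⁺; ∈-cartesianProduct⁻;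
         ∈-allFin; ∈-filter⁺; ∈-filter⁻; ∈-tabulate⁻)
open import Data.List.Membership.Propositional.Properties.WithK using (unique∧set⇒bag)
open import Data.List.Relation.Unary.All as All using (All)
open import Data.List.Relation.Unary.Any using (here)
open import Data.List.Relation.Unary.AllPairs using ([]; _∷_)
open import Data.List.Relation.Unary.Unique.Propositional using (Unique)
open import Data.List.Relation.Unary.Unique.Propositional.Properties
  using (map⁺; map⁻; ++⁺; filter⁺; allFin⁺; cartesianProduct⁺; cartesianProductWith⁺)
open import Data.List.Relation.Binary.BagAndSetEquality using (∼bag⇒↭)
import Data.List.Relation.Binary.Permutation.Propositional.Properties as ↭
open import Data.Product using (_×_; _,_; proj₁; proj₂; ∃)
open import Data.Sum using (_⊎_; inj₁; inj₂)
open import Data.Sum.Properties using (inj₁-injective; inj₂-injective)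
open import Data.Empty using (⊥; ⊥-elim)
open import Function using (id; _∘_; mk⇔)
open import Relation.Nullary using (¬_; Dec; yes; no)
open import Relation.Nullary.Decidable using (_×-dec_; _→-dec_; ¬?)
open import Relation.Binary.PropositionalEquality hiding ([_])
open import Algebra.Properties.CommutativeMonoid.Sum +-0-commutativeMonoid using (sum-remove) renaming (sum to ∑)

open import Defs

-- E n k is the case p = n, e = M = n + k + 1 of the family Q p e M of permutations of [M]
-- with excedance set [p] whose values at the remaining (tail) positions are < e; let W p e M be its
-- generating function. Two deletions give recurrences. For p ≤ e, an element of Q p (e+1) (M+1) outside
-- Q p e (M+1) has the value e at a unique tail position α ≥ e; deleting it leaves an element of Q p e M
-- and removes a left-to-right minimum of the tail exactly when α = p. Hence W p (e+1) (M+1) = W p e (M+1) + (M+1-e) W p e M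
-- for p < e, with M+1-e replaced by x^[p<M] + M - e when p = e. The last excedance position e of an element
-- of Q (e+1) (e+1) (M+1) holds any value b > e, and deleting it leaves the tail alone:
-- W (e+1) (e+1) (M+1) = (M - e) W e (e+1) M. Solving these, W m m (m+a) = a! (x+1)⋯(x+a-1) S(m,a), and
-- W n (n+t+1) (n+t+1+a) = Σ_j j! (x+1)⋯(x+j) S(n+1,j+1) S_{a+1}(t+a+1,j+1) with r-Stirling numbers S_r;
-- at a = 0 these are the S(t+1,j+1).

sum-map-bijection : {A B : Set} {xs : List A} {ys : List B} (f : A → ℕ) (h : B → A) (r : A → B) →
  Unique xs → Unique ys →
  (∀ {y} → y ∈ ys → h y ∈ xs × r (h y) ≡ y) →
  (∀ {x} → x ∈ xs → r x ∈ ys × h (r x) ≡ x) →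
  sum (map f xs) ≡ sum (map (f ∘ h) ys)
sum-map-bijection {xs = xs} {ys} f h r uxs uys h∈ r∈ =
  trans (sum-↭ (↭.map⁺ f xs↭hys)) (cong sum (sym (map-∘ ys)))
  where
  unique-hys : Unique (map h ys)
  unique-hys = map⁻ {f = r} (subst Unique (trans (sym (map-id-local (All.tabulate (proj₂ ∘ h∈)))) (map-∘ ys)) uys)
  to : ∀ {x} → x ∈ xs → x ∈ map h ys
  to x∈ = subst (_∈ map h ys) (proj₂ (r∈ x∈)) (∈-map⁺ h (proj₁ (r∈ x∈)))
  from : ∀ {x} → x ∈ map h ys → x ∈ xs
  from x∈ with ∈-map⁻ h x∈
  ... | y , y∈ , refl = proj₁ (h∈ y∈)
  xs↭hys = ∼bag⇒↭ (unique∧set⇒bag uxs unique-hys (mk⇔ to from))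

sum-map-+ : {A : Set} (f g : A → ℕ) (xs : List A) →
  sum (map (λ a → f a + g a) xs) ≡ sum (map f xs) + sum (map g xs)
sum-map-+ f g [] = refl
sum-map-+ f g (x ∷ xs) = trans (cong (f x + g x +_) (sum-map-+ f g xs)) (interchange (f x) (g x) _ _)
  where
  interchange : ∀ a b c d → a + b + (c + d) ≡ a + c + (b + d)
  interchange = solve-∀

sum-map-*ˡ : {A : Set} (c : ℕ) (f : A → ℕ) (xs : List A) → sum (map (λ a → c * f a) xs) ≡ c * sum (map f xs)
sum-map-*ˡ c f [] = sym (*-zeroʳ c)
sum-map-*ˡ c f (x ∷ xs) = trans (cong (c * f x +_) (sum-map-*ˡ c f xs)) (sym (*-distribˡ-+ c (f x) _))

sum-map-const : {A : Set} (c : ℕ) (xs : List A) → sum (map (λ _ → c) xs) ≡ length xs * c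
sum-map-const c [] = refl
sum-map-const c (x ∷ xs) = cong (c +_) (sum-map-const c xs)

sum-map-≡1 : {A : Set} (f : A → ℕ) (xs : List A) → (∀ {a} → a ∈ xs → f a ≡ 1) → sum (map f xs) ≡ length xs
sum-map-≡1 f xs ≡1 = trans (cong sum (map-cong-local (All.tabulate ≡1))) (trans (sum-map-const 1 xs) (*-identityʳ _))

sum-cartesianProduct : {A B : Set} (f : A × B → ℕ) (xs : List A) (ys : List B) →
  sum (map f (cartesianProduct xs ys)) ≡ sum (map (λ a → sum (map (λ b → f (a , b)) ys)) xs)
sum-cartesianProduct f [] ys = refl
sum-cartesianProduct f (x ∷ xs) ys = begin
  sum (map f (map (x ,_) ys ++ cartesianProduct xs ys))
    ≡⟨ cong sum (map-++ f (map (x ,_) ys) _) ⟩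
  sum (map f (map (x ,_) ys) ++ map f (cartesianProduct xs ys))
    ≡⟨ sum-++ (map f (map (x ,_) ys)) _ ⟩
  sum (map f (map (x ,_) ys)) + sum (map f (cartesianProduct xs ys))
    ≡⟨ cong₂ _+_ (cong sum (sym (map-∘ ys))) (sum-cartesianProduct f xs ys) ⟩
  sum (map (λ b → f (x , b)) ys) + sum (map (λ a → sum (map (λ b → f (a , b)) ys)) xs) ∎
  where open ≡-Reasoning

sum-weights-cartesianProduct : {A B : Set} (f : A → ℕ) (g : B → ℕ) (xs : List A) (ys : List B) →
  sum (map (λ (a , b) → f a * g b) (cartesianProduct xs ys)) ≡ sum (map f xs) * sum (map g ys)
sum-weights-cartesianProduct f g xs ys = begin
  sum (map (λ (a , b) → f a * g b) (cartesianProduct xs ys))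
    ≡⟨ sum-cartesianProduct _ xs ys ⟩
  sum (map (λ a → sum (map (λ b → f a * g b) ys)) xs)
    ≡⟨ cong sum (map-cong-local {xs = xs} (All.tabulate λ {a} _ → sum-map-*ˡ (f a) g ys)) ⟩
  sum (map (λ a → f a * sum (map g ys)) xs)
    ≡⟨ cong sum (map-cong-local {xs = xs} (All.tabulate λ {a} _ → *-comm (f a) _)) ⟩
  sum (map (λ a → sum (map g ys) * f a) xs)
    ≡⟨ sum-map-*ˡ (sum (map g ys)) f xs ⟩
  sum (map g ys) * sum (map f xs)
    ≡⟨ *-comm (sum (map g ys)) _ ⟩
  sum (map f xs) * sum (map g ys) ∎
  where open ≡-Reasoning

sum-map-⊎ : {A B : Set} (f : A ⊎ B → ℕ) (xs : List A) (ys : List B) →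
  sum (map f (map inj₁ xs ++ map inj₂ ys)) ≡ sum (map (f ∘ inj₁) xs) + sum (map (f ∘ inj₂) ys)
sum-map-⊎ f xs ys = begin
  sum (map f (map inj₁ xs ++ map inj₂ ys))
    ≡⟨ cong sum (map-++ f (map inj₁ xs) _) ⟩
  sum (map f (map inj₁ xs) ++ map f (map inj₂ ys))
    ≡⟨ sum-++ (map f (map inj₁ xs)) _ ⟩
  sum (map f (map inj₁ xs)) + sum (map f (map inj₂ ys))
    ≡⟨ cong₂ _+_ (cong sum (sym (map-∘ xs))) (cong sum (sym (map-∘ ys))) ⟩
  sum (map (f ∘ inj₁) xs) + sum (map (f ∘ inj₂) ys) ∎
  where open ≡-Reasoning

unique-⊎ : {A B : Set} {xs : List A} {ys : List B} → Unique xs → Unique ys →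
  Unique (map inj₁ xs ++ map inj₂ ys)
unique-⊎ uxs uys = ++⁺ (map⁺ inj₁-injective uxs) (map⁺ inj₂-injective uys) disjoint
  where
  disjoint : ∀ {z} → z ∈ map inj₁ _ × z ∈ map inj₂ _ → ⊥
  disjoint (z∈₁ , z∈₂) with ∈-map⁻ inj₁ z∈₁ | ∈-map⁻ inj₂ z∈₂
  ... | _ , _ , refl | _ , _ , ()

∈-⊎⁻ : {A B : Set} {xs : List A} {ys : List B} {z : A ⊎ B} → z ∈ map inj₁ xs ++ map inj₂ ys →
  (∃ λ a → z ≡ inj₁ a × a ∈ xs) ⊎ (∃ λ b → z ≡ inj₂ b × b ∈ ys)
∈-⊎⁻ {xs = xs} z∈ with ∈-++⁻ (map inj₁ xs) z∈
... | inj₁ z∈₁ with ∈-map⁻ inj₁ z∈₁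
...   | a , a∈ , refl = inj₁ (a , refl , a∈)
∈-⊎⁻ z∈ | inj₂ z∈₂ with ∈-map⁻ inj₂ z∈₂
...   | b , b∈ , refl = inj₂ (b , refl , b∈)

indicator : {P : Set} → Dec P → ℕ
indicator (yes _) = 1
indicator (no _) = 0

length-filter : {A : Set} {P : A → Set} (P? : (a : A) → Dec (P a)) (xs : List A) →
  length (filter P? xs) ≡ sum (map (indicator ∘ P?) xs)
length-filter P? [] = refl
length-filter P? (x ∷ xs) with P? x
... | yes _ = cong suc (length-filter P? xs)
... | no _ = length-filter P? xs

sum-tabulate : ∀ {n} (f : Fin n → ℕ) → sum (tabulate f) ≡ ∑ f
sum-tabulate {zero} f = refl
sum-tabulate {suc n} f = cong (f zero +_) (sum-tabulate (f ∘ suc))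

sum-allFin-punchIn : ∀ {n} (f : Fin (suc n) → ℕ) (α : Fin (suc n)) →
  sum (map f (allFin (suc n))) ≡ f α + sum (map (f ∘ punchIn α) (allFin n))
sum-allFin-punchIn {n} f α = begin
  sum (map f (allFin (suc n)))             ≡⟨ cong sum (map-tabulate id f) ⟩
  sum (tabulate f)                         ≡⟨ sum-tabulate f ⟩
  ∑ f                                      ≡⟨ sum-remove {i = α} f ⟩
  f α + ∑ (f ∘ punchIn α)                  ≡⟨ cong (f α +_) (sum-tabulate (f ∘ punchIn α)) ⟨
  f α + sum (tabulate (f ∘ punchIn α))     ≡⟨ cong (λ l → f α + sum l) (map-tabulate id (f ∘ punchIn α)) ⟨
  f α + sum (map (f ∘ punchIn α) (allFin n)) ∎
  where open ≡-Reasoning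

length-filter-allFin-punchIn : ∀ {n} {P : Fin (suc n) → Set} (P? : (a : Fin (suc n)) → Dec (P a)) (α : Fin (suc n)) →
  length (filter P? (allFin (suc n))) ≡ indicator (P? α) + length (filter (P? ∘ punchIn α) (allFin n))
length-filter-allFin-punchIn {n} P? α = begin
  length (filter P? (allFin (suc n)))
    ≡⟨ length-filter P? (allFin (suc n)) ⟩
  sum (map (indicator ∘ P?) (allFin (suc n)))
    ≡⟨ sum-allFin-punchIn (indicator ∘ P?) α ⟩
  indicator (P? α) + sum (map (indicator ∘ P? ∘ punchIn α) (allFin n))
    ≡⟨ cong (indicator (P? α) +_) (length-filter (P? ∘ punchIn α) (allFin n)) ⟨
  indicator (P? α) + length (filter (P? ∘ punchIn α) (allFin n)) ∎
  where open ≡-Reasoning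

concatMap-cons≡cartesianProductWith : {A : Set} {m : ℕ} (xs : List A) (vs : List (Vec A m)) →
  concatMap (λ a → map (a ∷_) vs) xs ≡ cartesianProductWith _∷_ xs vs
concatMap-cons≡cartesianProductWith [] vs = refl
concatMap-cons≡cartesianProductWith (x ∷ xs) vs = cong (map (x ∷_) vs ++_) (concatMap-cons≡cartesianProductWith xs vs)

allVecs-suc : {A : Set} (xs : List A) (m : ℕ) →
  allVecs xs (suc m) ≡ cartesianProductWith _∷_ xs (allVecs xs m)
allVecs-suc xs m = concatMap-cons≡cartesianProductWith xs (allVecs xs m)

∈-allVecs : {A : Set} {xs : List A} → (∀ a → a ∈ xs) → ∀ {m} (v : Vec A m) → v ∈ allVecs xs m
∈-allVecs complete [] = here refl
∈-allVecs {xs = xs} complete {suc m} (a ∷ v) =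
  subst (a ∷ v ∈_) (sym (allVecs-suc xs m)) (∈-cartesianProductWith⁺ _∷_ (complete a) (∈-allVecs complete v))

allVecs⁺ : {A : Set} {xs : List A} → Unique xs → ∀ m → Unique (allVecs xs m)
allVecs⁺ uxs zero = All.[] ∷ []
allVecs⁺ {xs = xs} uxs (suc m) =
  subst Unique (sym (allVecs-suc xs m)) (cartesianProductWith⁺ _∷_ ∷-injective uxs (allVecs⁺ uxs m))

m<o∸n⇒n+m<o : ∀ n {m o} → m < o ∸ n → n + m < o
m<o∸n⇒n+m<o zero lt = lt
m<o∸n⇒n+m<o (suc n) {o = suc o} lt = s≤s (m<o∸n⇒n+m<o n lt)

positionsFrom : (c N : ℕ) → List (Fin N)
positionsFrom c N = map (λ t → fromℕ< (m<o∸n⇒n+m<o c (toℕ<n t))) (allFin (N ∸ c))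

∈-positionsFrom⁻ : ∀ {c N} {α : Fin N} → α ∈ positionsFrom c N → c ≤ toℕ α
∈-positionsFrom⁻ {c} α∈ with ∈-map⁻ _ α∈
... | t , _ , refl = subst (c ≤_) (sym (toℕ-fromℕ< _)) (m≤m+n c (toℕ t))

∈-positionsFrom⁺ : ∀ {c N} (α : Fin N) → c ≤ toℕ α → α ∈ positionsFrom c N
∈-positionsFrom⁺ {c} {N} α c≤α = subst (_∈ positionsFrom c N) (toℕ-injective toℕ-position) (∈-map⁺ _ (∈-allFin t))
  where
  t : Fin (N ∸ c)
  t = fromℕ< (∸-monoˡ-< (toℕ<n α) c≤α)
  toℕ-position : toℕ (fromℕ< (m<o∸n⇒n+m<o c (toℕ<n t))) ≡ toℕ α
  toℕ-position = trans (toℕ-fromℕ< _) (trans (cong (c +_) (toℕ-fromℕ< _)) (m+[n∸m]≡n c≤α))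

positionsFrom⁺ : ∀ c N → Unique (positionsFrom c N)
positionsFrom⁺ c N = map⁺ injective (allFin⁺ (N ∸ c))
  where
  injective : ∀ {t t′} → fromℕ< (m<o∸n⇒n+m<o c (toℕ<n t)) ≡ fromℕ< (m<o∸n⇒n+m<o c (toℕ<n t′)) → t ≡ t′
  injective e = toℕ-injective (+-cancelˡ-≡ c _ _ (trans (sym (toℕ-fromℕ< _)) (trans (cong toℕ e) (toℕ-fromℕ< _))))

length-positionsFrom : ∀ c N → length (positionsFrom c N) ≡ N ∸ c
length-positionsFrom c N = trans (length-map _ (allFin (N ∸ c))) (length-tabulate _)

sum-positionsFrom : ∀ c N (g : ℕ → ℕ) →
  sum (map (g ∘ toℕ) (positionsFrom c N)) ≡ sum (map (λ t → g (c + toℕ t)) (allFin (N ∸ c)))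
sum-positionsFrom c N g = trans (cong sum (sym (map-∘ (allFin (N ∸ c)))))
  (cong sum (map-cong-local {xs = allFin (N ∸ c)} (All.tabulate λ {t} _ → cong g (toℕ-fromℕ< _))))

-- Inserting and deleting a position of a permutation

data PunchInView {n : ℕ} (i : Fin (suc n)) (j : Fin n) : Set where
  below : toℕ j < toℕ i → toℕ (punchIn i j) ≡ toℕ j → PunchInView i j
  above : toℕ i ≤ toℕ j → toℕ (punchIn i j) ≡ suc (toℕ j) → PunchInView i j

punchIn-view : ∀ {n} (i : Fin (suc n)) (j : Fin n) → PunchInView i j
punchIn-view zero j = above z≤n refl
punchIn-view (suc i) zero = below (s≤s z≤n) refl
punchIn-view (suc i) (suc j) with punchIn-view i j
... | below j<i eq = below (s≤s j<i) (cong suc eq)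
... | above i≤j eq = above (s≤s i≤j) (cong suc eq)

toℕ≤toℕ-punchIn : ∀ {n} (i : Fin (suc n)) (j : Fin n) → toℕ j ≤ toℕ (punchIn i j)
toℕ≤toℕ-punchIn i j with punchIn-view i j
... | below _ eq = ≤-reflexive (sym eq)
... | above _ eq = ≤-trans (n≤1+n _) (≤-reflexive (sym eq))

punchIn-mono-< : ∀ {n} (i : Fin (suc n)) {j k : Fin n} → toℕ j < toℕ k → toℕ (punchIn i j) < toℕ (punchIn i k)
punchIn-mono-< i {j} {k} j<k =
  ≤∧≢⇒< (punchIn-mono-≤ i j k (<⇒≤ j<k)) (λ e → <-irrefl (cong toℕ (punchIn-injective i j k (toℕ-injective e))) j<k)

punchIn-cancel-< : ∀ {n} (i : Fin (suc n)) {j k : Fin n} → toℕ (punchIn i j) < toℕ (punchIn i k) → toℕ j < toℕ k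
punchIn-cancel-< i {j} {k} lt =
  ≤∧≢⇒< (punchIn-cancel-≤ i j k (<⇒≤ lt)) (λ e → <-irrefl (cong (toℕ ∘ punchIn i) (toℕ-injective e)) lt)

data PositionView {n : ℕ} (i : Fin (suc n)) : Fin (suc n) → Set where
  at : PositionView i i
  punched : (j : Fin n) → PositionView i (punchIn i j)

position-view : ∀ {n} (i k : Fin (suc n)) → PositionView i k
position-view i k with i ≟ᶠ k
... | yes refl = at
... | no i≢k = subst (PositionView i) (punchIn-punchOut i≢k) (punched (punchOut i≢k))

lookup-ext : ∀ {A : Set} {n} {v w : Vec A n} → (∀ k → lookup v k ≡ lookup w k) → v ≡ w
lookup-ext {v = v} {w} eq = trans (sym (tabulate∘lookup v)) (trans (tabulate-cong eq) (tabulate∘lookup w))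

-- insert i u w: the permutation of Fin (suc M) sending i to u whose other values follow w
insert : ∀ {M} (i u : Fin (suc M)) → Vec (Fin M) M → Vec (Fin (suc M)) (suc M)
insert i u w = insertAt (Vec.map (punchIn u) w) i u

lookup-insert : ∀ {M} (i u : Fin (suc M)) (w : Vec (Fin M) M) → lookup (insert i u w) i ≡ u
lookup-insert i u w = insertAt-lookup (Vec.map (punchIn u) w) i u

lookup-insert-punchIn : ∀ {M} (i u : Fin (suc M)) (w : Vec (Fin M) M) (j : Fin M) →
  lookup (insert i u w) (punchIn i j) ≡ punchIn u (lookup w j)
lookup-insert-punchIn i u w j = trans (insertAt-punchIn (Vec.map (punchIn u) w) i u j) (lookup-map j (punchIn u) w)

toℕ-lookup-insert-punchIn : ∀ {M} (α u : Fin (suc M)) (w : Vec (Fin M) M) (j : Fin M) →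
  toℕ (lookup w j) < toℕ u → toℕ (lookup (insert α u w) (punchIn α j)) ≡ toℕ (lookup w j)
toℕ-lookup-insert-punchIn α u w j wj<u with punchIn-view u (lookup w j)
... | below _ eq = trans (cong toℕ (lookup-insert-punchIn α u w j)) eq
... | above u≤wj _ = ⊥-elim (<⇒≱ wj<u u≤wj)

punchOutOr : ∀ {M} → Fin (suc M) → Fin (suc M) → Fin M → Fin M
punchOutOr u z d with u ≟ᶠ z
... | yes _ = d
... | no u≢z = punchOut u≢z

punchIn-punchOutOr : ∀ {M} (u z : Fin (suc M)) (d : Fin M) → z ≢ u → punchIn u (punchOutOr u z d) ≡ z
punchIn-punchOutOr u z d z≢u with u ≟ᶠ z
... | yes u≡z = ⊥-elim (z≢u (sym u≡z))
... | no u≢z = punchIn-punchOut u≢z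

punchOutOr-punchIn : ∀ {M} (u : Fin (suc M)) (y d : Fin M) → punchOutOr u (punchIn u y) d ≡ y
punchOutOr-punchIn u y d with u ≟ᶠ punchIn u y
... | yes u≡ = ⊥-elim (punchInᵢ≢i u y (sym u≡))
... | no _ = punchOut-punchIn u

delete : ∀ {M} (i : Fin (suc M)) → Vec (Fin (suc M)) (suc M) → Vec (Fin M) M
delete i v = Vec.tabulate (λ j → punchOutOr (lookup v i) (lookup v (punchIn i j)) j)

punchIn-lookup-delete : ∀ {M} (i : Fin (suc M)) (v : Vec (Fin (suc M)) (suc M)) → IsPerm v → (j : Fin M) →
  punchIn (lookup v i) (lookup (delete i v) j) ≡ lookup v (punchIn i j)
punchIn-lookup-delete i v v-perm j = trans (cong (punchIn (lookup v i)) (lookup∘tabulate _ j))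
  (punchIn-punchOutOr (lookup v i) _ j (λ e → punchInᵢ≢i i j (v-perm _ _ e)))

delete-insert : ∀ {M} (i u : Fin (suc M)) (w : Vec (Fin M) M) → delete i (insert i u w) ≡ w
delete-insert i u w = lookup-ext λ j → begin
  lookup (delete i (insert i u w)) j
    ≡⟨ lookup∘tabulate _ j ⟩
  punchOutOr (lookup (insert i u w) i) (lookup (insert i u w) (punchIn i j)) j
    ≡⟨ cong₂ (λ a b → punchOutOr a b j) (lookup-insert i u w) (lookup-insert-punchIn i u w j) ⟩
  punchOutOr u (punchIn u (lookup w j)) j
    ≡⟨ punchOutOr-punchIn u (lookup w j) j ⟩
  lookup w j ∎
  where open ≡-Reasoning

insert-delete : ∀ {M} (i : Fin (suc M)) (v : Vec (Fin (suc M)) (suc M)) → IsPerm v →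
  insert i (lookup v i) (delete i v) ≡ v
insert-delete i v v-perm = lookup-ext λ k → agree k (position-view i k)
  where
  agree : ∀ k → PositionView i k → lookup (insert i (lookup v i) (delete i v)) k ≡ lookup v k
  agree _ at = lookup-insert i (lookup v i) (delete i v)
  agree _ (punched j) = trans (lookup-insert-punchIn i (lookup v i) (delete i v) j) (punchIn-lookup-delete i v v-perm j)

insert-isPerm : ∀ {M} (i u : Fin (suc M)) (w : Vec (Fin M) M) → IsPerm w → IsPerm (insert i u w)
insert-isPerm i u w w-perm a b = injective (position-view i a) (position-view i b)
  where
  v = insert i u w
  injective : ∀ {a b} → PositionView i a → PositionView i b → lookup v a ≡ lookup v b → a ≡ b
  injective at at _ = refl
  injective at (punched j) e =
    ⊥-elim (punchInᵢ≢i u (lookup w j) (trans (sym (lookup-insert-punchIn i u w j)) (trans (sym e) (lookup-insert i u w))))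
  injective (punched j) at e =
    ⊥-elim (punchInᵢ≢i u (lookup w j) (trans (sym (lookup-insert-punchIn i u w j)) (trans e (lookup-insert i u w))))
  injective (punched j) (punched k) e = cong (punchIn i) (w-perm j k
    (punchIn-injective u _ _ (trans (sym (lookup-insert-punchIn i u w j)) (trans e (lookup-insert-punchIn i u w k)))))

delete-isPerm : ∀ {M} (i : Fin (suc M)) (v : Vec (Fin (suc M)) (suc M)) → IsPerm v → IsPerm (delete i v)
delete-isPerm i v v-perm j k e = punchIn-injective i j k (v-perm _ _
  (trans (sym (punchIn-lookup-delete i v v-perm j))
    (trans (cong (punchIn (lookup v i)) e) (punchIn-lookup-delete i v v-perm k))))

-- Permutations with excedance set [p] and bounded tail

TailBelow : {M : ℕ} → ℕ → ℕ → Vec (Fin M) M → Set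
TailBelow {M} p e v = (i : Fin M) → p ≤ toℕ i → toℕ (lookup v i) < e

tailBelow? : {M : ℕ} (p e : ℕ) (v : Vec (Fin M) M) → Dec (TailBelow p e v)
tailBelow? p e v = all? (λ i → (p ≤? toℕ i) →-dec (toℕ (lookup v i) <? e))

InQ : {M : ℕ} → ℕ → ℕ → Vec (Fin M) M → Set
InQ p e v = IsPerm v × ExcSetIs p v × TailBelow p e v

inQ? : {M : ℕ} (p e : ℕ) (v : Vec (Fin M) M) → Dec (InQ p e v)
inQ? p e v = isPerm? v ×-dec excSetIs? p v ×-dec tailBelow? p e v

Q : ℕ → ℕ → (M : ℕ) → List (Vec (Fin M) M)
Q p e M = filter (inQ? p e) (allVecs (allFin M) M)

W : ℕ → ℕ → ℕ → ℕ → ℕ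
W x p e M = sum (map (λ v → x ^ wlr p v) (Q p e M))

ShapeAt : ℕ → ℕ → ℕ → ℕ → Set
ShapeAt p e k y = (k < p → k < y) × (p ≤ k → y ≤ k × y < e)

Shape : {M : ℕ} → ℕ → ℕ → Vec (Fin M) M → Set
Shape {M} p e v = (i : Fin M) → ShapeAt p e (toℕ i) (toℕ (lookup v i))

module _ {p e M : ℕ} {v : Vec (Fin M) M} where

  Shape⇒InQ : IsPerm v → Shape p e v → InQ p e v
  Shape⇒InQ v-perm shape = v-perm
    , (λ i → proj₁ (shape i) , λ i≮p i<vi → <⇒≱ i<vi (proj₁ (proj₂ (shape i) (≮⇒≥ i≮p))))
    , (λ i p≤i → proj₂ (proj₂ (shape i) p≤i))

  InQ⇒Shape : InQ p e v → Shape p e v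
  InQ⇒Shape (_ , exc , tail) i = proj₁ (exc i) , λ p≤i → ≮⇒≥ (proj₂ (exc i) (≤⇒≯ p≤i)) , tail i p≤i

  ∈Q⁺ : InQ p e v → v ∈ Q p e M
  ∈Q⁺ = ∈-filter⁺ (inQ? p e) (∈-allVecs ∈-allFin v)

  ∈Q⁻ : v ∈ Q p e M → InQ p e v
  ∈Q⁻ v∈ = proj₂ (∈-filter⁻ (inQ? p e) {xs = allVecs (allFin M) M} v∈)

  ∈Q⇒IsPerm : v ∈ Q p e M → IsPerm v
  ∈Q⇒IsPerm = proj₁ ∘ ∈Q⁻

  ∈Q⇒Shape : v ∈ Q p e M → Shape p e v
  ∈Q⇒Shape = InQ⇒Shape ∘ ∈Q⁻

  Shape⇒∈Q : IsPerm v → Shape p e v → v ∈ Q p e M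
  Shape⇒∈Q v-perm = ∈Q⁺ ∘ Shape⇒InQ v-perm

Q⁺ : ∀ p e M → Unique (Q p e M)
Q⁺ p e M = filter⁺ (inQ? p e) (allVecs⁺ (allFin⁺ M) M)

module _ {p e M : ℕ} (α u : Fin (suc M)) (w : Vec (Fin M) M) where

  Shape-insert : ShapeAt p e (toℕ α) (toℕ u) →
    (∀ j → ShapeAt p e (toℕ (punchIn α j)) (toℕ (punchIn u (lookup w j)))) →
    Shape p e (insert α u w)
  Shape-insert shape-α shape-punchIn k with position-view α k
  ... | at rewrite lookup-insert α u w = shape-α
  ... | punched j rewrite lookup-insert-punchIn α u w j = shape-punchIn j

  Shape-insert-punchIn : Shape p e (insert α u w) →
    ∀ j → ShapeAt p e (toℕ (punchIn α j)) (toℕ (punchIn u (lookup w j)))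
  Shape-insert-punchIn shape j = subst (ShapeAt p e (toℕ (punchIn α j)) ∘ toℕ) (lookup-insert-punchIn α u w j) (shape (punchIn α j))

-- Left-to-right minima of the tail

lrCount : {M : ℕ} → ℕ → Vec (Fin M) M → ℕ
lrCount {M} p v = length (filter (lrMin? p v) (allFin M))

lrCount≡0 : ∀ {M} p (w : Vec (Fin M) M) → M ≤ p → lrCount p w ≡ 0
lrCount≡0 {M} p w M≤p = cong length (filter-none (lrMin? p w) {xs = allFin M}
  (All.tabulate λ {i} _ i-min → <⇒≱ (toℕ<n i) (≤-trans M≤p (proj₁ i-min))))

lrCount>0 : ∀ {M} p (w : Vec (Fin M) M) → p < M → 1 ≤ lrCount p w
lrCount>0 {suc M} p w p<M with lrMin? p w (fromℕ< p<M) | length-filter-allFin-punchIn (lrMin? p w) (fromℕ< p<M)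
... | yes _ | eq = ≤-trans (s≤s z≤n) (≤-reflexive (sym eq))
... | no not-min | _ = ⊥-elim (not-min (≤-reflexive (sym (toℕ-fromℕ< p<M))
  , λ j p≤j j<p → ⊥-elim (<⇒≱ (subst (toℕ j <_) (toℕ-fromℕ< p<M) j<p) p≤j)))

sgn : ℕ → ℕ
sgn zero = 0
sgn (suc _) = 1

lrCount≡sgn+wlr : ∀ {M} p (w : Vec (Fin M) M) → lrCount p w ≡ sgn (M ∸ p) + wlr p w
lrCount≡sgn+wlr {M} p w with p <? M
... | yes p<M = trans (sym (m+[n∸m]≡n (lrCount>0 p w p<M))) (cong (_+ wlr p w) (sym (sgn-pos (m<n⇒0<n∸m p<M))))
  where
  sgn-pos : ∀ {a} → 0 < a → sgn a ≡ 1
  sgn-pos {suc _} _ = refl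
... | no p≮M rewrite lrCount≡0 p w (≮⇒≥ p≮M) | m≤n⇒m∸n≡0 (≮⇒≥ p≮M) = refl

module LRMinTransfer {p′ p M : ℕ} (α : Fin (suc M)) (v : Vec (Fin (suc M)) (suc M)) (w : Vec (Fin M) M)
  (tail⁺ : ∀ j → p ≤ toℕ j → p′ ≤ toℕ (punchIn α j))
  (tail⁻ : ∀ j → p′ ≤ toℕ (punchIn α j) → p ≤ toℕ j)
  (tail-value : ∀ j → p ≤ toℕ j → toℕ (lookup v (punchIn α j)) ≡ toℕ (lookup w j))
  (α-above-tail : p′ ≤ toℕ α → ∀ j → p ≤ toℕ j → toℕ (lookup w j) < toℕ (lookup v α))
  where

  LRMin-punchIn⁺ : ∀ j → LRMin p w j → LRMin p′ v (punchIn α j)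
  LRMin-punchIn⁺ j (p≤j , minimal) = tail⁺ j p≤j , λ m p′≤m m<k → earlier (position-view α m) p′≤m m<k
    where
    earlier : ∀ {m} → PositionView α m → p′ ≤ toℕ m → toℕ m < toℕ (punchIn α j) →
      toℕ (lookup v (punchIn α j)) < toℕ (lookup v m)
    earlier at p′≤α _ = subst (_< _) (sym (tail-value j p≤j)) (α-above-tail p′≤α j p≤j)
    earlier (punched j′) p′≤k′ k′<k = subst₂ _<_ (sym (tail-value j p≤j)) (sym (tail-value j′ p≤j′))
      (minimal j′ p≤j′ (punchIn-cancel-< α k′<k))
      where p≤j′ = tail⁻ j′ p′≤k′

  LRMin-punchIn⁻ : ∀ j → LRMin p′ v (punchIn α j) → LRMin p w j
  LRMin-punchIn⁻ j (p′≤k , minimal) = p≤j , λ j′ p≤j′ j′<j → subst₂ _<_ (tail-value j p≤j) (tail-value j′ p≤j′)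
      (minimal (punchIn α j′) (tail⁺ j′ p≤j′) (punchIn-mono-< α j′<j))
    where p≤j = tail⁻ j p′≤k

  lrCount-punchIn : lrCount p′ v ≡ indicator (lrMin? p′ v α) + lrCount p w
  lrCount-punchIn = trans (length-filter-allFin-punchIn (lrMin? p′ v) α)
    (cong (λ l → indicator (lrMin? p′ v α) + length l)
      (filter-≐ (lrMin? p′ v ∘ punchIn α) (lrMin? p w) (LRMin-punchIn⁻ _ , LRMin-punchIn⁺ _) (allFin M)))

-- The two insertions and the recurrences they give

insertionFactor : ℕ → ℕ → ℕ → ℕ → ℕ
insertionFactor x p M a with a ≟ p
... | yes _ = x ^ sgn (M ∸ p)
... | no _ = 1

-- Inserting the value e at a tail position α ≥ e: e is then the largest tail value.
module TailInsertion {p e M : ℕ} (p≤e : p ≤ e) (α u : Fin (suc M)) (e≤α : e ≤ toℕ α) (u≡e : toℕ u ≡ e) where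

  p≤α : p ≤ toℕ α
  p≤α = ≤-trans p≤e e≤α

  shapeAt-punchIn⁺ : ∀ j y → ShapeAt p e (toℕ j) (toℕ y) → ShapeAt p (suc e) (toℕ (punchIn α j)) (toℕ (punchIn u y))
  shapeAt-punchIn⁺ j y (exc , tail) with punchIn-view α j | punchIn-view u y
  ... | below _ k≡j | below _ y′≡y rewrite k≡j | y′≡y =
    exc , λ p≤j → proj₁ (tail p≤j) , m<n⇒m<1+n (proj₂ (tail p≤j))
  ... | below _ k≡j | above u≤y y′≡y rewrite k≡j | y′≡y =
    (λ j<p → m<n⇒m<1+n (exc j<p)) , λ p≤j → ⊥-elim (<⇒≱ (proj₂ (tail p≤j)) (subst (_≤ toℕ y) u≡e u≤y))
  ... | above α≤j k≡j+1 | below y<u y′≡y rewrite k≡j+1 | y′≡y =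
    (λ j+1<p → ⊥-elim (<⇒≱ j+1<p (≤-trans p≤α (m≤n⇒m≤1+n α≤j))))
    , λ _ → m≤n⇒m≤1+n (proj₁ (tail p≤j)) , m<n⇒m<1+n (proj₂ (tail p≤j))
    where p≤j = ≤-trans p≤α α≤j
  ... | above α≤j _ | above u≤y _ =
    ⊥-elim (<⇒≱ (proj₂ (tail (≤-trans p≤α α≤j))) (subst (_≤ toℕ y) u≡e u≤y))

  shapeAt-punchIn⁻ : ∀ j y → ShapeAt p (suc e) (toℕ (punchIn α j)) (toℕ (punchIn u y)) → ShapeAt p e (toℕ j) (toℕ y)
  shapeAt-punchIn⁻ j y (exc , tail) with punchIn-view α j | punchIn-view u y
  ... | below _ k≡j | below y<u y′≡y rewrite k≡j | y′≡y =
    exc , λ p≤j → proj₁ (tail p≤j) , subst (toℕ y <_) u≡e y<u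
  ... | below _ k≡j | above u≤y y′≡y rewrite k≡j | y′≡y =
    (λ j<p → <-≤-trans j<p (≤-trans p≤e (subst (_≤ toℕ y) u≡e u≤y)))
    , λ p≤j → ⊥-elim (<⇒≱ (s≤s⁻¹ (proj₂ (tail p≤j))) (subst (_≤ toℕ y) u≡e u≤y))
  ... | above α≤j k≡j+1 | below y<u y′≡y rewrite k≡j+1 | y′≡y =
    (λ j<p → ⊥-elim (<⇒≱ j<p (≤-trans p≤α α≤j)))
    , λ _ → <⇒≤ (<-≤-trans y<e (≤-trans e≤α α≤j)) , y<e
    where y<e = subst (toℕ y <_) u≡e y<u
  ... | above α≤j k≡j+1 | above u≤y y′≡y+1 rewrite k≡j+1 | y′≡y+1 =
    ⊥-elim (<⇒≱ (s≤s⁻¹ (proj₂ (tail (m≤n⇒m≤1+n (≤-trans p≤α α≤j))))) (subst (_≤ toℕ y) u≡e u≤y))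

  shapeAt-α : ShapeAt p (suc e) (toℕ α) (toℕ u)
  shapeAt-α rewrite u≡e = (λ α<p → ⊥-elim (<⇒≱ α<p p≤α)) , λ _ → e≤α , n<1+n e

  Shape-insert⁺ : (w : Vec (Fin M) M) → Shape p e w → Shape p (suc e) (insert α u w)
  Shape-insert⁺ w shape = Shape-insert α u w shapeAt-α (λ j → shapeAt-punchIn⁺ j (lookup w j) (shape j))

  Shape-insert⁻ : (w : Vec (Fin M) M) → Shape p (suc e) (insert α u w) → Shape p e w
  Shape-insert⁻ w shape j = shapeAt-punchIn⁻ j (lookup w j) (Shape-insert-punchIn α u w shape j)

  module _ (x : ℕ) (w : Vec (Fin M) M) (shape : Shape p e w) where

    private
      v = insert α u w

      tail-value : ∀ j → p ≤ toℕ j → toℕ (lookup v (punchIn α j)) ≡ toℕ (lookup w j)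
      tail-value j p≤j = toℕ-lookup-insert-punchIn α u w j (subst (toℕ (lookup w j) <_) (sym u≡e) (proj₂ (proj₂ (shape j) p≤j)))

      tail⁻ : ∀ j → p ≤ toℕ (punchIn α j) → p ≤ toℕ j
      tail⁻ j p≤k with punchIn-view α j
      ... | below _ k≡j = subst (p ≤_) k≡j p≤k
      ... | above α≤j _ = ≤-trans p≤α α≤j

      α-above-tail : p ≤ toℕ α → ∀ j → p ≤ toℕ j → toℕ (lookup w j) < toℕ (lookup v α)
      α-above-tail _ j p≤j =
        subst (toℕ (lookup w j) <_) (sym (trans (cong toℕ (lookup-insert α u w)) u≡e)) (proj₂ (proj₂ (shape j) p≤j))

    open LRMinTransfer α v w (λ j p≤j → ≤-trans p≤j (toℕ≤toℕ-punchIn α j)) tail⁻ tail-value α-above-tail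

    LRMin-α⇒α≡p : LRMin p v α → toℕ α ≡ p
    LRMin-α⇒α≡p (_ , minimal) with toℕ α ≟ p
    ... | yes α≡p = α≡p
    ... | no α≢p = ⊥-elim (<-asym (minimal (punchIn α j) (≤-reflexive (sym k≡p)) (subst (_< toℕ α) (sym k≡p) p<α))
                                  (subst (_< toℕ (lookup v α)) (sym (tail-value j p≤j)) (α-above-tail p≤α j p≤j)))
      where
      p<α = ≤∧≢⇒< p≤α (α≢p ∘ sym)
      p<M = <-≤-trans p<α (s≤s⁻¹ (toℕ<n α))
      j = fromℕ< p<M
      p≤j = ≤-reflexive (sym (toℕ-fromℕ< p<M))
      k≡p : toℕ (punchIn α j) ≡ p
      k≡p with punchIn-view α j
      ... | below _ eq = trans eq (toℕ-fromℕ< p<M)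
      ... | above α≤j _ = ⊥-elim (<⇒≱ p<α (subst (toℕ α ≤_) (toℕ-fromℕ< p<M) α≤j))

    α≡p⇒LRMin-α : toℕ α ≡ p → LRMin p v α
    α≡p⇒LRMin-α α≡p = ≤-reflexive (sym α≡p) , λ m p≤m m<α → ⊥-elim (<⇒≱ (subst (toℕ m <_) α≡p m<α) p≤m)

    weight-insert : x ^ wlr p v ≡ insertionFactor x p M (toℕ α) * x ^ wlr p w
    weight-insert with toℕ α ≟ p | lrMin? p v α | lrCount-punchIn
    ... | yes α≡p | no not-min | _ = ⊥-elim (not-min (α≡p⇒LRMin-α α≡p))
    ... | no α≢p | yes min | _ = ⊥-elim (α≢p (LRMin-α⇒α≡p min))
    ... | no _ | no _ | count≡ = trans (cong (λ c → x ^ (c ∸ 1)) count≡) (sym (*-identityˡ _))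
    ... | yes _ | yes _ | count≡ = trans (cong (λ c → x ^ (c ∸ 1)) count≡)
      (trans (cong (x ^_) (lrCount≡sgn+wlr p w)) (^-distribˡ-+-* x (sgn (M ∸ p)) (wlr p w)))

-- Inserting a value b > e at position e, which becomes the last excedance.
module ExcedanceInsertion {e M : ℕ} (i₀ b : Fin (suc M)) (i₀≡e : toℕ i₀ ≡ e) (e<b : e < toℕ b) where

  shapeAt-punchIn⁺ : ∀ j y → ShapeAt e (suc e) (toℕ j) (toℕ y) →
    ShapeAt (suc e) (suc e) (toℕ (punchIn i₀ j)) (toℕ (punchIn b y))
  shapeAt-punchIn⁺ j y (exc , tail) with punchIn-view i₀ j | punchIn-view b y
  ... | below j<i₀ k≡j | below _ y′≡y rewrite k≡j | y′≡y =
    (λ _ → exc j<e) , λ e<j → ⊥-elim (<⇒≱ j<e (<⇒≤ e<j))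
    where j<e = subst (toℕ j <_) i₀≡e j<i₀
  ... | below j<i₀ k≡j | above _ y′≡y+1 rewrite k≡j | y′≡y+1 =
    (λ _ → m<n⇒m<1+n (exc j<e)) , λ e<j → ⊥-elim (<⇒≱ j<e (<⇒≤ e<j))
    where j<e = subst (toℕ j <_) i₀≡e j<i₀
  ... | above i₀≤j k≡j+1 | below _ y′≡y rewrite k≡j+1 | y′≡y =
    (λ j+1<e+1 → ⊥-elim (<⇒≱ (s≤s⁻¹ j+1<e+1) e≤j)) , λ _ → m≤n⇒m≤1+n (proj₁ (tail e≤j)) , proj₂ (tail e≤j)
    where e≤j = subst (_≤ toℕ j) i₀≡e i₀≤j
  ... | above i₀≤j _ | above b≤y _ =
    ⊥-elim (<⇒≱ (proj₂ (tail (subst (_≤ toℕ j) i₀≡e i₀≤j))) (≤-trans e<b b≤y))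

  shapeAt-punchIn⁻ : ∀ j y → ShapeAt (suc e) (suc e) (toℕ (punchIn i₀ j)) (toℕ (punchIn b y)) →
    ShapeAt e (suc e) (toℕ j) (toℕ y)
  shapeAt-punchIn⁻ j y (exc , tail) with punchIn-view i₀ j | punchIn-view b y
  ... | below j<i₀ k≡j | below _ y′≡y rewrite k≡j | y′≡y =
    (λ _ → exc (m<n⇒m<1+n j<e)) , λ e≤j → ⊥-elim (<⇒≱ j<e e≤j)
    where j<e = subst (toℕ j <_) i₀≡e j<i₀
  ... | below j<i₀ k≡j | above b≤y y′≡y+1 rewrite k≡j | y′≡y+1 =
    (λ _ → <-trans j<e (<-≤-trans e<b b≤y)) , λ e≤j → ⊥-elim (<⇒≱ j<e e≤j)
    where j<e = subst (toℕ j <_) i₀≡e j<i₀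
  ... | above i₀≤j k≡j+1 | below _ y′≡y rewrite k≡j+1 | y′≡y =
    (λ j<e → ⊥-elim (<⇒≱ j<e e≤j)) , λ _ → ≤-trans (s≤s⁻¹ y<e+1) e≤j , y<e+1
    where
    e≤j = subst (_≤ toℕ j) i₀≡e i₀≤j
    y<e+1 = proj₂ (tail (s≤s e≤j))
  ... | above i₀≤j k≡j+1 | above b≤y y′≡y+1 rewrite k≡j+1 | y′≡y+1 =
    ⊥-elim (<⇒≱ (s≤s⁻¹ (proj₂ (tail (s≤s (subst (_≤ toℕ j) i₀≡e i₀≤j))))) (<⇒≤ (<-≤-trans e<b b≤y)))

  shapeAt-i₀ : ShapeAt (suc e) (suc e) (toℕ i₀) (toℕ b)
  shapeAt-i₀ rewrite i₀≡e = (λ _ → e<b) , λ e+1≤e → ⊥-elim (<-irrefl refl e+1≤e)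

  Shape-insert⁺ : (w : Vec (Fin M) M) → Shape e (suc e) w → Shape (suc e) (suc e) (insert i₀ b w)
  Shape-insert⁺ w shape = Shape-insert i₀ b w shapeAt-i₀ (λ j → shapeAt-punchIn⁺ j (lookup w j) (shape j))

  Shape-insert⁻ : (w : Vec (Fin M) M) → Shape (suc e) (suc e) (insert i₀ b w) → Shape e (suc e) w
  Shape-insert⁻ w shape j = shapeAt-punchIn⁻ j (lookup w j) (Shape-insert-punchIn i₀ b w shape j)


  module _ (w : Vec (Fin M) M) (shape : Shape e (suc e) w) where

    private
      v = insert i₀ b w

      tail⁺ : ∀ j → e ≤ toℕ j → suc e ≤ toℕ (punchIn i₀ j)
      tail⁺ j e≤j with punchIn-view i₀ j
      ... | below j<i₀ _ = ⊥-elim (<⇒≱ (subst (toℕ j <_) i₀≡e j<i₀) e≤j)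
      ... | above _ k≡j+1 = subst (suc e ≤_) (sym k≡j+1) (s≤s e≤j)

      tail⁻ : ∀ j → suc e ≤ toℕ (punchIn i₀ j) → e ≤ toℕ j
      tail⁻ j e<k with punchIn-view i₀ j
      ... | below j<i₀ k≡j = ⊥-elim (<⇒≱ (subst (toℕ j <_) i₀≡e j<i₀) (<⇒≤ (subst (e <_) k≡j e<k)))
      ... | above i₀≤j _ = subst (_≤ toℕ j) i₀≡e i₀≤j

      tail-value : ∀ j → e ≤ toℕ j → toℕ (lookup v (punchIn i₀ j)) ≡ toℕ (lookup w j)
      tail-value j e≤j = toℕ-lookup-insert-punchIn i₀ b w j (<-≤-trans (proj₂ (proj₂ (shape j) e≤j)) e<b)

      i₀-not-tail : suc e ≤ toℕ i₀ → ∀ j → e ≤ toℕ j → toℕ (lookup w j) < toℕ (lookup v i₀)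
      i₀-not-tail e<i₀ = ⊥-elim (<-irrefl (sym i₀≡e) e<i₀)

    open LRMinTransfer i₀ v w tail⁺ tail⁻ tail-value i₀-not-tail

    wlr-insert : wlr (suc e) v ≡ wlr e w
    wlr-insert with lrMin? (suc e) v i₀ | lrCount-punchIn
    ... | yes (e<i₀ , _) | _ = ⊥-elim (<-irrefl (sym i₀≡e) e<i₀)
    ... | no _ | count≡ = cong (_∸ 1) count≡

module TailRecurrence (x p e M : ℕ) (p≤e : p ≤ e) (e≤M : e ≤ M) where

  private
    N = suc M
    u : Fin N
    u = fromℕ< (s≤s e≤M)
    u≡e : toℕ u ≡ e
    u≡e = toℕ-fromℕ< (s≤s e≤M)
    weight : ∀ {K} → Vec (Fin K) K → ℕ
    weight v = x ^ wlr p v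
    insertions = cartesianProduct (positionsFrom e N) (Q p e M)
    Pieces = Vec (Fin N) N ⊎ (Fin N × Vec (Fin M) M)
    pieces : List Pieces
    pieces = map inj₁ (Q p e N) ++ map inj₂ insertions

  open TailInsertion {M = M} p≤e using (Shape-insert⁺; Shape-insert⁻; weight-insert)

  assemble : Pieces → Vec (Fin N) N
  assemble (inj₁ v) = v
  assemble (inj₂ (α , w)) = insert α u w

  ViolationAt : Vec (Fin N) N → Fin N → Set
  ViolationAt v i = p ≤ toℕ i × ¬ toℕ (lookup v i) < e

  violationAt? : (v : Vec (Fin N) N) (i : Fin N) → Dec (ViolationAt v i)
  violationAt? v i = (p ≤? toℕ i) ×-dec ¬? (toℕ (lookup v i) <? e)

  split : Vec (Fin N) N → Pieces
  split v with inQ? p e v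
  ... | yes _ = inj₁ v
  ... | no _ with any? (violationAt? v)
  ...   | yes (i , _) = inj₂ (i , delete i v)
  ...   | no _ = inj₁ v

  violation⇒value≡e : ∀ v {i} → Shape p (suc e) v → ViolationAt v i → toℕ (lookup v i) ≡ e
  violation⇒value≡e v {i} shape (p≤i , ≮e) = ≤-antisym (s≤s⁻¹ (proj₂ (proj₂ (shape i) p≤i))) (≮⇒≥ ≮e)

  violation⇒e≤position : ∀ v {i} → Shape p (suc e) v → ViolationAt v i → e ≤ toℕ i
  violation⇒e≤position v {i} shape violation@(p≤i , _) =
    subst (_≤ toℕ i) (violation⇒value≡e v shape violation) (proj₁ (proj₂ (shape i) p≤i))

  no-violation⇒InQ : ∀ {v} → v ∈ Q p (suc e) N → ¬ ∃ (ViolationAt v) → InQ p e v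
  no-violation⇒InQ {v} v∈ no-violation = ∈Q⇒IsPerm v∈ , proj₁ (proj₂ (∈Q⁻ v∈)) , tail
    where
    tail : TailBelow p e v
    tail i p≤i with toℕ (lookup v i) <? e
    ... | yes <e = <e
    ... | no ≮e = ⊥-elim (no-violation (i , p≤i , ≮e))

  delete-violation : ∀ {v i} → v ∈ Q p (suc e) N → ViolationAt v i →
    (i , delete i v) ∈ insertions × insert i u (delete i v) ≡ v
  delete-violation {v} {i} v∈ violation =
    ∈-cartesianProduct⁺ (∈-positionsFrom⁺ i e≤i) (Shape⇒∈Q (delete-isPerm i v v-perm) shape-w) , v≡
    where
    v-perm = ∈Q⇒IsPerm v∈
    shape = ∈Q⇒Shape v∈
    e≤i = violation⇒e≤position v shape violation
    v≡ : insert i u (delete i v) ≡ v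
    v≡ = trans (cong (λ z → insert i z (delete i v)) (toℕ-injective (trans u≡e (sym (violation⇒value≡e v shape violation)))))
      (insert-delete i v v-perm)
    shape-w : Shape p e (delete i v)
    shape-w = Shape-insert⁻ i u e≤i u≡e (delete i v) (subst (Shape p (suc e)) (sym v≡) shape)

  Q-weaken : ∀ {v : Vec (Fin N) N} → v ∈ Q p e N → v ∈ Q p (suc e) N
  Q-weaken v∈ with ∈Q⁻ v∈
  ... | v-perm , exc , tail = ∈Q⁺ (v-perm , exc , λ i p≤i → m<n⇒m<1+n (tail i p≤i))

  insert∈Q : ∀ {α w} → α ∈ positionsFrom e N → w ∈ Q p e M → insert α u w ∈ Q p (suc e) N
  insert∈Q {α} {w} α∈ w∈ = Shape⇒∈Q (insert-isPerm α u w (∈Q⇒IsPerm w∈))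
    (Shape-insert⁺ α u (∈-positionsFrom⁻ α∈) u≡e w (∈Q⇒Shape w∈))

  assemble∈ : ∀ {y} → y ∈ pieces → assemble y ∈ Q p (suc e) N × split (assemble y) ≡ y
  assemble∈ y∈ with ∈-⊎⁻ {xs = Q p e N} {ys = insertions} y∈
  ... | inj₁ (v , refl , v∈) = Q-weaken v∈ , split-v
    where
    split-v : split v ≡ inj₁ v
    split-v with inQ? p e v
    ... | yes _ = refl
    ... | no v∉ = ⊥-elim (v∉ (∈Q⁻ v∈))
  ... | inj₂ ((α , w) , refl , αw∈) = v∈ , split-v
    where
    α∈ = proj₁ (∈-cartesianProduct⁻ (positionsFrom e N) (Q p e M) αw∈)
    v = insert α u w
    v∈ = insert∈Q α∈ (proj₂ (∈-cartesianProduct⁻ (positionsFrom e N) (Q p e M) αw∈))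
    value-α : toℕ (lookup v α) ≡ e
    value-α = trans (cong toℕ (lookup-insert α u w)) u≡e
    p≤α = ≤-trans p≤e (∈-positionsFrom⁻ α∈)
    split-v : split v ≡ inj₂ (α , w)
    split-v with inQ? p e v
    ... | yes (_ , _ , tail) = ⊥-elim (<-irrefl value-α (tail α p≤α))
    ... | no _ with any? (violationAt? v)
    ...   | no no-violation = ⊥-elim (no-violation (α , p≤α , <-irrefl value-α))
    ...   | yes (i , violation) = cong inj₂ (cong₂ _,_ i≡α (trans (cong (λ k → delete k v) i≡α) (delete-insert α u w)))
      where
      i≡α : i ≡ α
      i≡α = ∈Q⇒IsPerm v∈ i α (toℕ-injective (trans (violation⇒value≡e v (∈Q⇒Shape v∈) violation) (sym value-α)))

  split∈ : ∀ {v} → v ∈ Q p (suc e) N → split v ∈ pieces × assemble (split v) ≡ v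
  split∈ {v} v∈ with inQ? p e v
  ... | yes v∈Qe = ∈-++⁺ˡ (∈-map⁺ inj₁ (∈Q⁺ v∈Qe)) , refl
  ... | no v∉Qe with any? (violationAt? v)
  ...   | no no-violation = ⊥-elim (v∉Qe (no-violation⇒InQ v∈ no-violation))
  ...   | yes (i , violation) with delete-violation v∈ violation
  ...     | iw∈ , v≡ = ∈-++⁺ʳ (map inj₁ (Q p e N)) (∈-map⁺ inj₂ iw∈) , v≡

  W-tail-recurrence : W x p (suc e) N ≡
    W x p e N + sum (map (insertionFactor x p M ∘ toℕ) (positionsFrom e N)) * W x p e M
  W-tail-recurrence = begin
    W x p (suc e) N
      ≡⟨ sum-map-bijection weight assemble split (Q⁺ p (suc e) N)
           (unique-⊎ (Q⁺ p e N) (cartesianProduct⁺ (positionsFrom⁺ e N) (Q⁺ p e M))) assemble∈ split∈ ⟩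
    sum (map (weight ∘ assemble) pieces)
      ≡⟨ sum-map-⊎ (weight ∘ assemble) (Q p e N) _ ⟩
    W x p e N + sum (map (weight ∘ assemble ∘ inj₂) insertions)
      ≡⟨ cong (λ l → W x p e N + sum l) (map-cong-local (All.tabulate weight-inserted)) ⟩
    W x p e N + sum (map (λ (α , w) → insertionFactor x p M (toℕ α) * weight w) insertions)
      ≡⟨ cong (W x p e N +_) (sum-weights-cartesianProduct _ weight (positionsFrom e N) (Q p e M)) ⟩
    W x p e N + sum (map (insertionFactor x p M ∘ toℕ) (positionsFrom e N)) * W x p e M ∎
    where
    open ≡-Reasoning
    weight-inserted : ∀ {αw} → αw ∈ insertions →
      weight (insert (proj₁ αw) u (proj₂ αw)) ≡ insertionFactor x p M (toℕ (proj₁ αw)) * weight (proj₂ αw)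
    weight-inserted {α , w} αw∈ with ∈-cartesianProduct⁻ (positionsFrom e N) (Q p e M) αw∈
    ... | α∈ , w∈ = weight-insert α u (∈-positionsFrom⁻ α∈) u≡e x w (∈Q⇒Shape w∈)

module ExcedanceRecurrence (x e M : ℕ) (e≤M : e ≤ M) where

  private
    N = suc M
    i₀ : Fin N
    i₀ = fromℕ< (s≤s e≤M)
    i₀≡e : toℕ i₀ ≡ e
    i₀≡e = toℕ-fromℕ< (s≤s e≤M)
    pieces = cartesianProduct (positionsFrom (suc e) N) (Q e (suc e) M)

  open ExcedanceInsertion {e = e} {M = M} i₀ using (Shape-insert⁺; Shape-insert⁻; wlr-insert)

  assemble : Fin N × Vec (Fin M) M → Vec (Fin N) N
  assemble (b , w) = insert i₀ b w

  split : Vec (Fin N) N → Fin N × Vec (Fin M) M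
  split v = lookup v i₀ , delete i₀ v

  assemble∈ : ∀ {y} → y ∈ pieces → assemble y ∈ Q (suc e) (suc e) N × split (assemble y) ≡ y
  assemble∈ {b , w} bw∈ with ∈-cartesianProduct⁻ (positionsFrom (suc e) N) (Q e (suc e) M) bw∈
  ... | b∈ , w∈ =
    Shape⇒∈Q (insert-isPerm i₀ b w (∈Q⇒IsPerm w∈)) (Shape-insert⁺ b i₀≡e (∈-positionsFrom⁻ b∈) w (∈Q⇒Shape w∈))
                , cong₂ _,_ (lookup-insert i₀ b w) (delete-insert i₀ b w)

  split∈ : ∀ {v} → v ∈ Q (suc e) (suc e) N → split v ∈ pieces × assemble (split v) ≡ v
  split∈ {v} v∈ = ∈-cartesianProduct⁺ (∈-positionsFrom⁺ b e<b) (Shape⇒∈Q (delete-isPerm i₀ v v-perm) shape-w)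
                , insert-delete i₀ v v-perm
    where
    v-perm = ∈Q⇒IsPerm v∈
    shape = ∈Q⇒Shape v∈
    b = lookup v i₀
    e<b : e < toℕ b
    e<b = subst (_< toℕ b) i₀≡e (proj₁ (shape i₀) (subst (_< suc e) (sym i₀≡e) (n<1+n e)))
    shape-w : Shape e (suc e) (delete i₀ v)
    shape-w = Shape-insert⁻ b i₀≡e e<b (delete i₀ v) (subst (Shape (suc e) (suc e)) (sym (insert-delete i₀ v v-perm)) shape)

  W-excedance-recurrence : W x (suc e) (suc e) N ≡ (M ∸ e) * W x e (suc e) M
  W-excedance-recurrence = begin
    W x (suc e) (suc e) N
      ≡⟨ sum-map-bijection (λ v → x ^ wlr (suc e) v) assemble split (Q⁺ (suc e) (suc e) N)
           (cartesianProduct⁺ (positionsFrom⁺ (suc e) N) (Q⁺ e (suc e) M)) assemble∈ split∈ ⟩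
    sum (map (λ (b , w) → x ^ wlr (suc e) (insert i₀ b w)) pieces)
      ≡⟨ cong sum (map-cong-local (All.tabulate weight-inserted)) ⟩
    sum (map (λ (b , w) → 1 * x ^ wlr e w) pieces)
      ≡⟨ sum-weights-cartesianProduct (λ _ → 1) (λ w → x ^ wlr e w) (positionsFrom (suc e) N) (Q e (suc e) M) ⟩
    sum (map (λ _ → 1) (positionsFrom (suc e) N)) * W x e (suc e) M
      ≡⟨ cong (_* W x e (suc e) M) (trans (sum-map-≡1 _ (positionsFrom (suc e) N) (λ _ → refl)) (length-positionsFrom (suc e) N)) ⟩
    (M ∸ e) * W x e (suc e) M ∎
    where
    open ≡-Reasoning
    weight-inserted : ∀ {bw} → bw ∈ pieces → x ^ wlr (suc e) (insert i₀ (proj₁ bw) (proj₂ bw)) ≡ 1 * x ^ wlr e (proj₂ bw)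
    weight-inserted {b , w} bw∈ with ∈-cartesianProduct⁻ (positionsFrom (suc e) N) (Q e (suc e) M) bw∈
    ... | b∈ , w∈ = trans (cong (x ^_) (wlr-insert b i₀≡e (∈-positionsFrom⁻ b∈) w (∈Q⇒Shape w∈))) (sym (*-identityˡ _))

insertionFactor-≢ : ∀ x p M a → a ≢ p → insertionFactor x p M a ≡ 1
insertionFactor-≢ x p M a a≢p with a ≟ p
... | yes a≡p = ⊥-elim (a≢p a≡p)
... | no _ = refl

insertionFactor-≡ : ∀ x p M → insertionFactor x p M p ≡ x ^ sgn (M ∸ p)
insertionFactor-≡ x p M with p ≟ p
... | yes _ = refl
... | no p≢p = ⊥-elim (p≢p refl)

factorSum-< : ∀ x p e M → p < e → sum (map (insertionFactor x p M ∘ toℕ) (positionsFrom e (suc M))) ≡ suc M ∸ e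
factorSum-< x p e M p<e = begin
  sum (map (insertionFactor x p M ∘ toℕ) (positionsFrom e (suc M)))
    ≡⟨ sum-positionsFrom e (suc M) (insertionFactor x p M) ⟩
  sum (map (λ t → insertionFactor x p M (e + toℕ t)) (allFin (suc M ∸ e)))
    ≡⟨ sum-map-≡1 _ (allFin (suc M ∸ e)) (λ {t} _ → insertionFactor-≢ x p M _ (e+t≢p t)) ⟩
  length (allFin (suc M ∸ e))
    ≡⟨ length-tabulate _ ⟩
  suc M ∸ e ∎
  where
  open ≡-Reasoning
  e+t≢p : ∀ {m} (t : Fin m) → e + toℕ t ≢ p
  e+t≢p t e+t≡p = <⇒≱ p<e (subst (e ≤_) e+t≡p (m≤m+n e (toℕ t)))

factorSum-≡ : ∀ x e M → e ≤ M →
  sum (map (insertionFactor x e M ∘ toℕ) (positionsFrom e (suc M))) ≡ x ^ sgn (M ∸ e) + (M ∸ e)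
factorSum-≡ x e M e≤M = begin
  sum (map (insertionFactor x e M ∘ toℕ) (positionsFrom e (suc M)))
    ≡⟨ sum-positionsFrom e (suc M) (insertionFactor x e M) ⟩
  sum (map f (allFin (suc M ∸ e)))
    ≡⟨ cong (sum ∘ map f ∘ allFin) (+-∸-assoc 1 e≤M) ⟩
  f {suc (M ∸ e)} zero + sum (map f (tabulate {n = M ∸ e} suc))
    ≡⟨ cong₂ _+_ (trans (cong (insertionFactor x e M) (+-identityʳ e)) (insertionFactor-≡ x e M))
                 (sum-map-≡1 f (tabulate suc) later≡1) ⟩
  x ^ sgn (M ∸ e) + length (tabulate {n = M ∸ e} suc)
    ≡⟨ cong (x ^ sgn (M ∸ e) +_) (length-tabulate suc) ⟩
  x ^ sgn (M ∸ e) + (M ∸ e) ∎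
  where
  open ≡-Reasoning
  f : ∀ {m} → Fin m → ℕ
  f t = insertionFactor x e M (e + toℕ t)
  later≡1 : ∀ {t} → t ∈ tabulate {n = M ∸ e} suc → f t ≡ 1
  later≡1 t∈ with ∈-tabulate⁻ t∈
  ... | t′ , refl = insertionFactor-≢ x e M _ (λ e+1+t≡e → <-irrefl (sym e+1+t≡e) e<e+1+t)
    where e<e+1+t = ≤-trans (s≤s (m≤m+n e (toℕ t′))) (≤-reflexive (sym (+-suc e (toℕ t′))))

-- Solving the recurrences

W-0-0-0 : ∀ x → W x 0 0 0 ≡ 1
W-0-0-0 x with inQ? 0 0 ([] {A = Fin 0})
... | yes _ = refl
... | no ∉ = ⊥-elim (∉ ((λ ()) , (λ ()) , (λ ())))

W-0-0-suc : ∀ x M → W x 0 0 (suc M) ≡ 0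
W-0-0-suc x M = cong (sum ∘ map (λ v → x ^ wlr 0 v))
  (filter-none (inQ? 0 0) {xs = allVecs (allFin (suc M)) (suc M)} (All.tabulate λ { _ (_ , _ , tail) → n≮0 (tail zero z≤n) }))

rise-step : ∀ x a → (x ^ sgn a + a) * rise x (a ∸ 1) ≡ rise x a
rise-step x zero = refl
rise-step x (suc a) = trans (cong (λ y → (y + suc a) * rise x a) (*-identityʳ x)) (*-comm (x + suc a) (rise x a))

mutual
  W-diagonal : ∀ x m a → W x m m (m + a) ≡ a ! * rise x (a ∸ 1) * S m a
  W-diagonal x zero zero = W-0-0-0 x
  W-diagonal x zero (suc a) = trans (W-0-0-suc x a) (sym (*-zeroʳ (suc a ! * rise x a)))
  W-diagonal x (suc m) a = begin
    W x (suc m) (suc m) (suc m + a)      ≡⟨ ExcedanceRecurrence.W-excedance-recurrence x m (m + a) (m≤m+n m a) ⟩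
    (m + a ∸ m) * W x m (suc m) (m + a)  ≡⟨ cong (_* W x m (suc m) (m + a)) (m+n∸m≡n m a) ⟩
    a * W x m (suc m) (m + a)            ≡⟨ excedance-value a ⟩
    a ! * rise x (a ∸ 1) * S (suc m) a   ∎
    where
    open ≡-Reasoning
    excedance-value : ∀ a → a * W x m (suc m) (m + a) ≡ a ! * rise x (a ∸ 1) * S (suc m) a
    excedance-value zero = refl
    excedance-value (suc a) = begin
      suc a * W x m (suc m) (m + suc a)      ≡⟨ cong (λ K → suc a * W x m (suc m) K) (+-suc m a) ⟩
      suc a * W x m (suc m) (suc m + a)      ≡⟨ cong (suc a *_) (W-first x m a) ⟩
      suc a * (a ! * rise x a * S (suc m) (suc a)) ≡⟨ reassociate (suc a) (a !) (rise x a) (S (suc m) (suc a)) ⟩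
      suc a ! * rise x a * S (suc m) (suc a) ∎
      where
      reassociate : ∀ b f r s → b * (f * r * s) ≡ b * f * r * s
      reassociate = solve-∀

  W-first : ∀ x n a → W x n (suc n) (suc n + a) ≡ a ! * rise x a * S (suc n) (suc a)
  W-first x n a = begin
    W x n (suc n) (suc n + a)
      ≡⟨ TailRecurrence.W-tail-recurrence x n n (n + a) ≤-refl (m≤m+n n a) ⟩
    W x n n (suc (n + a)) + sum (map (insertionFactor x n (n + a) ∘ toℕ) (positionsFrom n (suc (n + a)))) * W x n n (n + a)
      ≡⟨ cong (λ F → W x n n (suc (n + a)) + F * W x n n (n + a))
           (trans (factorSum-≡ x n (n + a) (m≤m+n n a)) (cong (λ b → x ^ sgn b + b) (m+n∸m≡n n a))) ⟩
    W x n n (suc (n + a)) + c * W x n n (n + a)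
      ≡⟨ cong₂ (λ A B → A + c * B) (trans (cong (W x n n) (sym (+-suc n a))) (W-diagonal x n (suc a))) (W-diagonal x n a) ⟩
    suc a ! * rise x a * S n (suc a) + c * (a ! * rise x (a ∸ 1) * S n a)
      ≡⟨ cong (suc a ! * rise x a * S n (suc a) +_) (pull-out c (a !) (rise x (a ∸ 1)) (S n a)) ⟩
    suc a ! * rise x a * S n (suc a) + a ! * (c * rise x (a ∸ 1)) * S n a
      ≡⟨ cong (λ ρ → suc a ! * rise x a * S n (suc a) + a ! * ρ * S n a) (rise-step x a) ⟩
    suc a * a ! * rise x a * S n (suc a) + a ! * rise x a * S n a
      ≡⟨ factor (suc a) (a !) (rise x a) (S n (suc a)) (S n a) ⟩
    a ! * rise x a * S (suc n) (suc a) ∎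
    where
    open ≡-Reasoning
    c = x ^ sgn a + a
    pull-out : ∀ c f r s → c * (f * r * s) ≡ f * (c * r) * s
    pull-out = solve-∀
    factor : ∀ b f r s₁ s₀ → b * f * r * s₁ + f * r * s₀ ≡ f * r * (b * s₁ + s₀)
    factor = solve-∀

V : ℕ → ℕ → ℕ → ℕ → ℕ
V x n t a = W x n (t + n) (t + n + a)

V-step : ∀ x n t a → V x n (suc (suc t)) a ≡ V x n (suc t) (suc a) + suc a * V x n (suc t) a
V-step x n t a = begin
  W x n (suc e) (suc M)
    ≡⟨ TailRecurrence.W-tail-recurrence x n e M (m≤n+m n (suc t)) (m≤m+n e a) ⟩
  W x n e (suc M) + sum (map (insertionFactor x n M ∘ toℕ) (positionsFrom e (suc M))) * W x n e M
    ≡⟨ cong₂ (λ A F → A + F * W x n e M) (cong (W x n e) (sym (+-suc e a)))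
         (trans (factorSum-< x n e M (s≤s (m≤n+m n t))) (trans (+-∸-assoc 1 (m≤m+n e a)) (cong suc (m+n∸m≡n e a)))) ⟩
  W x n e (e + suc a) + suc a * W x n e M ∎
  where
  open ≡-Reasoning
  e = suc t + n
  M = e + a

δ : ℕ → ℕ → ℕ
δ zero zero = 1
δ zero (suc _) = 0
δ (suc _) zero = 0
δ (suc j) (suc a) = δ j a

δ-refl : ∀ a → δ a a ≡ 1
δ-refl zero = refl
δ-refl (suc a) = δ-refl a

δ-≢ : ∀ j a → j ≢ a → δ j a ≡ 0
δ-≢ zero zero j≢a = ⊥-elim (j≢a refl)
δ-≢ zero (suc a) _ = refl
δ-≢ (suc j) zero _ = refl
δ-≢ (suc j) (suc a) j≢a = δ-≢ j a (j≢a ∘ cong suc)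

*-δ-swap : ∀ (f : ℕ → ℕ) j a → f a * δ j a ≡ f j * δ j a
*-δ-swap f j a with j ≟ a
... | yes refl = refl
... | no j≢a rewrite δ-≢ j a j≢a = trans (*-zeroʳ (f a)) (sym (*-zeroʳ (f j)))

-- R s a j is the (a+1)-Stirling number S_{a+1}(s+a+1, j+1): partitions of [s+a+1] into j+1 blocks
-- that separate 1, …, a+1.
R : ℕ → ℕ → ℕ → ℕ
R zero a j = δ j a
R (suc s) a j = R s (suc a) j + suc a * R s a j

shift : (ℕ → ℕ) → ℕ → ℕ
shift f zero = 0
shift f (suc j) = f j

R-stirling-recurrence : ∀ s a j → R (suc s) a j ≡ suc j * R s a j + shift (R s a) j
R-stirling-recurrence zero a zero = trans (cong (δ 0 (suc a) +_) (*-δ-swap suc 0 a)) (sym (+-identityʳ _))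
R-stirling-recurrence zero a (suc j) = trans (cong (δ j a +_) (*-δ-swap suc (suc j) a)) (+-comm (δ j a) _)
R-stirling-recurrence (suc s) a j = begin
  R (suc s) (suc a) j + suc a * R (suc s) a j
    ≡⟨ cong₂ (λ A B → A + suc a * B) (R-stirling-recurrence s (suc a) j) (R-stirling-recurrence s a j) ⟩
  (suc j * R s (suc a) j + shift (R s (suc a)) j) + suc a * (suc j * R s a j + shift (R s a) j)
    ≡⟨ regroup (suc j) (suc a) (R s (suc a) j) (shift (R s (suc a)) j) (R s a j) (shift (R s a) j) ⟩
  suc j * (R s (suc a) j + suc a * R s a j) + (shift (R s (suc a)) j + suc a * shift (R s a) j)
    ≡⟨ cong (suc j * R (suc s) a j +_) (shift-linear j) ⟩
  suc j * R (suc s) a j + shift (R (suc s) a) j ∎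
  where
  open ≡-Reasoning
  regroup : ∀ j a p q r t → (j * p + q) + a * (j * r + t) ≡ j * (p + a * r) + (q + a * t)
  regroup = solve-∀
  shift-linear : ∀ j → shift (R s (suc a)) j + suc a * shift (R s a) j ≡ shift (R (suc s) a) j
  shift-linear zero = *-zeroʳ (suc a)
  shift-linear (suc j) = refl

R≡S : ∀ s j → R s 0 j ≡ S (suc s) (suc j)
R≡S zero zero = refl
R≡S zero (suc j) = sym (trans (+-identityʳ _) (*-zeroʳ (suc (suc j))))
R≡S (suc s) j = trans (R-stirling-recurrence s 0 j) (cong₂ _+_ (cong (suc j *_) (R≡S s j)) (shifted j))
  where
  shifted : ∀ j → shift (R s 0) j ≡ S (suc s) j
  shifted zero = refl
  shifted (suc j) = R≡S s j

S-vanish : ∀ n k → n < k → S n k ≡ 0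
S-vanish zero (suc k) _ = refl
S-vanish (suc n) (suc k) (s≤s n<k) =
  cong₂ _+_ (trans (cong (suc k *_) (S-vanish n (suc k) (m<n⇒m<1+n n<k))) (*-zeroʳ (suc k))) (S-vanish n k n<k)

sumTo : ℕ → (ℕ → ℕ) → ℕ
sumTo L g = sum (map g (upTo L))

infix 8 sumTo
syntax sumTo L (λ j → g) = Σ[ j < L ] g

sumTo-suc : ∀ L g → sumTo (suc L) g ≡ sumTo L g + g L
sumTo-suc L g = begin
  sum (map g (upTo (suc L)))        ≡⟨ cong (sum ∘ map g) (upTo-∷ʳ L) ⟨
  sum (map g (upTo L ++ [ L ]))     ≡⟨ cong sum (map-++ g (upTo L) [ L ]) ⟩
  sum (map g (upTo L) ++ [ g L ])   ≡⟨ sum-++ (map g (upTo L)) [ g L ] ⟩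
  sumTo L g + (g L + 0)             ≡⟨ cong (sumTo L g +_) (+-identityʳ (g L)) ⟩
  sumTo L g + g L                   ∎
  where open ≡-Reasoning

sumTo-cong : ∀ L {f g : ℕ → ℕ} → (∀ j → f j ≡ g j) → sumTo L f ≡ sumTo L g
sumTo-cong L f≡g = cong sum (map-cong f≡g (upTo L))

sumTo-extend : ∀ L d g → (∀ j → L ≤ j → j < L + d → g j ≡ 0) → sumTo (L + d) g ≡ sumTo L g
sumTo-extend L zero g _ = cong (λ K → sumTo K g) (+-identityʳ L)
sumTo-extend L (suc d) g vanish = begin
  sumTo (L + suc d) g         ≡⟨ cong (λ K → sumTo K g) (+-suc L d) ⟩
  sumTo (suc (L + d)) g       ≡⟨ sumTo-suc (L + d) g ⟩
  sumTo (L + d) g + g (L + d) ≡⟨ cong₂ _+_ (sumTo-extend L d g vanish′)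
                                          (vanish (L + d) (m≤m+n L d) (≤-reflexive (sym (+-suc L d)))) ⟩
  sumTo L g + 0               ≡⟨ +-identityʳ _ ⟩
  sumTo L g                   ∎
  where
  open ≡-Reasoning
  vanish′ : ∀ j → L ≤ j → j < L + d → g j ≡ 0
  vanish′ j L≤j j<L+d = vanish j L≤j (≤-trans j<L+d (≤-trans (n≤1+n _) (≤-reflexive (sym (+-suc L d)))))

sumTo-δ : ∀ L a (g : ℕ → ℕ) → (L ≤ a → g a ≡ 0) → Σ[ j < L ] (g j * δ j a) ≡ g a
sumTo-δ zero a g vanish = sym (vanish z≤n)
sumTo-δ (suc L) a g vanish with L ≟ a
... | yes refl = begin
  Σ[ j < suc L ] (g j * δ j L)     ≡⟨ sumTo-suc L (λ j → g j * δ j L) ⟩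
  Σ[ j < L ] (g j * δ j L) + g L * δ L L
    ≡⟨ cong₂ _+_ (sumTo-extend 0 L (λ j → g j * δ j L) earlier-vanish) (cong (g L *_) (δ-refl L)) ⟩
  0 + g L * 1                      ≡⟨ *-identityʳ (g L) ⟩
  g L                              ∎
  where
  open ≡-Reasoning
  earlier-vanish : ∀ j → 0 ≤ j → j < L → g j * δ j L ≡ 0
  earlier-vanish j _ j<L = trans (cong (g j *_) (δ-≢ j L (<⇒≢ j<L))) (*-zeroʳ (g j))
... | no L≢a = begin
  Σ[ j < suc L ] (g j * δ j a)     ≡⟨ sumTo-suc L (λ j → g j * δ j a) ⟩
  Σ[ j < L ] (g j * δ j a) + g L * δ L a
    ≡⟨ cong₂ _+_ (sumTo-δ L a g (λ L≤a → vanish (≤∧≢⇒< L≤a L≢a)))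
                 (trans (cong (g L *_) (δ-≢ L a L≢a)) (*-zeroʳ (g L))) ⟩
  g a + 0                          ≡⟨ +-identityʳ (g a) ⟩
  g a                              ∎
  where open ≡-Reasoning

coef : ℕ → ℕ → ℕ → ℕ
coef x n j = j ! * rise x j * S (suc n) (suc j)

V-closed : ∀ x n s a → V x n (suc s) a ≡ Σ[ j < suc n ] (coef x n j * R s a j)
V-closed x n zero a = trans (W-first x n a) (sym (sumTo-δ (suc n) a (coef x n) coef-vanish))
  where
  coef-vanish : suc n ≤ a → coef x n a ≡ 0
  coef-vanish n<a =
    trans (cong (a ! * rise x a *_) (S-vanish (suc n) (suc a) (s≤s n<a))) (*-zeroʳ (a ! * rise x a))
V-closed x n (suc s) a = begin
  V x n (suc (suc s)) a
    ≡⟨ V-step x n s a ⟩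
  V x n (suc s) (suc a) + suc a * V x n (suc s) a
    ≡⟨ cong₂ (λ A B → A + suc a * B) (V-closed x n s (suc a)) (V-closed x n s a) ⟩
  Σ[ j < suc n ] (coef x n j * R s (suc a) j) + suc a * Σ[ j < suc n ] (coef x n j * R s a j)
    ≡⟨ cong (Σ[ j < suc n ] (coef x n j * R s (suc a) j) +_)
         (sum-map-*ˡ (suc a) (λ j → coef x n j * R s a j) (upTo (suc n))) ⟨
  Σ[ j < suc n ] (coef x n j * R s (suc a) j) + Σ[ j < suc n ] (suc a * (coef x n j * R s a j))
    ≡⟨ sum-map-+ (λ j → coef x n j * R s (suc a) j) (λ j → suc a * (coef x n j * R s a j)) (upTo (suc n)) ⟨
  Σ[ j < suc n ] (coef x n j * R s (suc a) j + suc a * (coef x n j * R s a j))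
    ≡⟨ sumTo-cong (suc n) (λ j → distrib (coef x n j) (R s (suc a) j) (suc a) (R s a j)) ⟩
  Σ[ j < suc n ] (coef x n j * R (suc s) a j) ∎
  where
  open ≡-Reasoning
  distrib : ∀ c r b r′ → c * r + b * (c * r′) ≡ c * (r + b * r′)
  distrib = solve-∀

lhs≡W : ∀ n k x → lhs n k x ≡ W x n (n + k + 1) (n + k + 1)
lhs≡W n k x = cong (sum ∘ map (λ v → x ^ wlr n v))
  (filter-≐ (inE? n k) (inQ? n (n + k + 1))
    ((λ {v} (v-perm , exc) → v-perm , exc , λ i _ → toℕ<n (lookup v i)) , λ (v-perm , exc , _) → v-perm , exc)
    (allVecs (allFin (n + k + 1)) (n + k + 1)))

Bhat-summand-vanish : ∀ n k x j → n ⊓ k < j → j ! * rise x j * S (suc n) (suc j) * S (suc k) (suc j) ≡ 0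
Bhat-summand-vanish n k x j n⊓k<j with ≤-total n k
... | inj₁ n≤k
  rewrite S-vanish (suc n) (suc j) (s≤s (subst (_< j) (m≤n⇒m⊓n≡m n≤k) n⊓k<j))
        | *-zeroʳ (j ! * rise x j) = refl
... | inj₂ k≤n
  rewrite S-vanish (suc k) (suc j) (s≤s (subst (_< j) (m≥n⇒m⊓n≡n k≤n) n⊓k<j)) =
    *-zeroʳ (j ! * rise x j * S (suc n) (suc j))

theorem4p4 : (n k x : ℕ) → lhs n k x ≡ Bhat n k x
theorem4p4 n k x = begin
  lhs n k x
    ≡⟨ lhs≡W n k x ⟩
  W x n (n + k + 1) (n + k + 1)
    ≡⟨ cong₂ (W x n) N≡ (trans N≡ (sym (+-identityʳ (suc k + n)))) ⟩
  V x n (suc k) 0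
    ≡⟨ V-closed x n k 0 ⟩
  Σ[ j < suc n ] (coef x n j * R k 0 j)
    ≡⟨ sumTo-cong (suc n) (λ j → cong (coef x n j *_) (R≡S k j)) ⟩
  Σ[ j < suc n ] (coef x n j * S (suc k) (suc j))
    ≡⟨ cong (λ L → Σ[ j < L ] (coef x n j * S (suc k) (suc j))) (cong suc (m+[n∸m]≡n (m⊓n≤m n k))) ⟨
  Σ[ j < suc (n ⊓ k) + (n ∸ n ⊓ k) ] (coef x n j * S (suc k) (suc j))
    ≡⟨ sumTo-extend (suc (n ⊓ k)) (n ∸ n ⊓ k) _ (λ j n⊓k<j _ → Bhat-summand-vanish n k x j n⊓k<j) ⟩
  Bhat n k x ∎
  where
  open ≡-Reasoning
  N≡ : n + k + 1 ≡ suc k + n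
  N≡ = trans (+-comm (n + k) 1) (cong suc (+-comm n k))
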